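{- Let $G$ be a connected graph with $\delta(G)\ge2$ and let $T_{\mathcal{B}}$ be a reduced block tree of $G$. Then every leaf of $T_{\mathcal{B}}$ is a block of $G$ with at least $3$ vertices which induces a $2$-connected subgraph.
   Context: A block of a graph $G$ is a maximal set $B\subseteq V(G)$ such that for any two vertices $x,y\in B$ with $xy\notin E(G)$, at least $2$ vertices must be removed from $G$ to separate $x$ from $y$. The block decomposition $\mathcal{B}(G)$ is the set of all blocks. The block graph $G_{\mathcal{B}}$ has vertex set $\mathcal{B}(G)$, with $B_1B_2$ an edge iff $B_1\cap B_2\ne\emptyset$. A reduced block tree of a connected graph $G$ is a spanning tree $T_{\mathcal{B}}$ of $G_{\mathcal{B}}$. -}

module Defs where

open import Data.Nat using (ℕ; _≤_; _<_)
open import Data.Fin using (Fin)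
open import Data.Fin.Subset using (Subset; _∈_; _∉_; _⊆_; _∩_; Nonempty; ∣_∣)
open import Data.List using (List; []; _∷_; length; _∷ʳ_)
open import Data.List.Relation.Unary.Linked using (Linked)
open import Data.List.Relation.Unary.Unique.Propositional using (Unique)
open import Data.Product using (Σ; ∃; _×_)
open import Relation.Nullary using (¬_)
open import Relation.Binary using (Rel; Decidable)
open import Relation.Binary.PropositionalEquality using (_≡_; _≢_)
open import Relation.Binary.Construct.Closure.ReflexiveTransitive using (Star)

record Graph (n : ℕ) : Set₁ where
  field
    Adj     : Fin n → Fin n → Set
    adj?    : Decidable Adj
    sym     : ∀ {x y} → Adj x y → Adj y x
    irrefl  : ∀ {x} → ¬ Adj x x

module _ {n : ℕ} (G : Graph n) where
  open Graph G

  AdjIn : (Fin n → Set) → Fin n → Fin n → Set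
  AdjIn S x y = S x × S y × Adj x y

  -- x and y are joined by a walk all of whose vertices satisfy S
  -- (with S x, S y assumed separately where needed)
  ReachIn : (Fin n → Set) → Fin n → Fin n → Set
  ReachIn S = Star (AdjIn S)

  Connected : Set
  Connected = ∀ x y → Star Adj x y

  MinDegree≥2 : Set
  MinDegree≥2 = ∀ v → Σ (Fin n) λ u → Σ (Fin n) λ w → u ≢ w × Adj v u × Adj v w

  NotSeparableBy≤1 : Fin n → Fin n → Set
  NotSeparableBy≤1 x y =
    Star Adj x y × (∀ z → z ≢ x → z ≢ y → ReachIn (λ v → v ≢ z) x y)

  BlockCandidate : Subset n → Set
  BlockCandidate B = ∀ x y → x ∈ B → y ∈ B → ¬ Adj x y → NotSeparableBy≤1 x y

  IsBlock : Subset n → Set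
  IsBlock B = BlockCandidate B × (∀ B′ → B ⊆ B′ → BlockCandidate B′ → B′ ⊆ B)

  BlockGraphEdge : Subset n → Subset n → Set
  BlockGraphEdge B₁ B₂ = IsBlock B₁ × IsBlock B₂ × B₁ ≢ B₂ × Nonempty (B₁ ∩ B₂)

  HasCycle : Rel (Subset n) _ → Set
  HasCycle T = Σ (Subset n) λ x → Σ (List (Subset n)) λ ys →
    2 ≤ length ys × Unique (x ∷ ys) × Linked T ((x ∷ ys) ∷ʳ x)

  -- T is a reduced block tree: a spanning tree of the block graph,
  -- given by its (symmetric) edge relation on the blocks
  record ReducedBlockTree (T : Rel (Subset n) _) : Set where
    field
      edges-in-GB : ∀ B₁ B₂ → T B₁ B₂ → BlockGraphEdge B₁ B₂
      T-sym       : ∀ B₁ B₂ → T B₁ B₂ → T B₂ B₁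
      spanning-connected : ∀ B₁ B₂ → IsBlock B₁ → IsBlock B₂ → Star T B₁ B₂
      acyclic     : ¬ HasCycle T

  IsLeaf : Rel (Subset n) _ → Subset n → Set
  IsLeaf T B = Σ (Subset n) λ B′ → T B B′ × (∀ B″ → T B B″ → B″ ≡ B′)

  InducesTwoConnected : Subset n → Set
  InducesTwoConnected B =
    2 < ∣ B ∣
    × (∀ x y → x ∈ B → y ∈ B → ReachIn (λ v → v ∈ B) x y)
    × (∀ z → z ∈ B → ∀ x y → x ∈ B → y ∈ B → x ≢ z → y ≢ z →
         ReachIn (λ v → v ∈ B × v ≢ z) x y)

-- A walk that leaves a block B at a vertex a can only come back to B through a:
-- were it to return at b ≠ a, B together with the first vertex outside it would
-- still be a block candidate.  Hence every walk between two vertices of B (in G,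
-- or in G − z) can be cut down to one inside B, which makes B induce a
-- 2-connected graph once it has three vertices.  A block is never a single
-- vertex, as an edge is a candidate.  Suppose a leaf B of the tree has just two
-- vertices, x shared with its unique tree neighbour B′, and y.  As δ(G) ≥ 2, y
-- has a neighbour w ≠ x, so some block lies on y's side of the bridge xy (all of
-- its vertices reach y in G − x).  Tree neighbours of such a block are again on
-- y's side, or B itself, which is only adjacent to B′ ∋ x; so B′ is unreachable
-- in the spanning tree.

module Submission where

open import Defs
open import Function using (_∘_)
open import Data.Nat using (ℕ; _≤_; s≤s; z≤n; suc)
open import Data.Nat.Properties using (≤-trans)
open import Data.Fin using (Fin; _≟_)
open import Data.Fin.Properties using (any?)
open import Data.Fin.Subset using (Subset; ∣_∣; _∈_; _∉_; _⊆_; _∪_; ⁅_⁆; _-_)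
open import Data.Fin.Subset.Properties
  using (_∈?_; x∈⁅x⁆; x∈⁅y⁆⇒x≡y; ⊆-antisym; p⊆p∪q; q⊆p∪q; x∈p∪q⁻; x∈p∪q⁺;
         x∈p∩q⁻; x∈p∧x≢y⇒x∈p-y; x∈p⇒∣p-x∣<∣p∣)
open import Data.Product using (∃; _×_; _,_; proj₁; proj₂)
open import Data.Sum using (_⊎_; inj₁; inj₂; [_,_]; map₁)
open import Data.Empty using (⊥; ⊥-elim)
open import Data.Unit using (⊤; tt)
open import Data.List using (List; []; _∷_; allFin)
open import Data.List.Relation.Unary.Any using (here; there)
import Data.List.Membership.Propositional as List
open import Data.List.Membership.Propositional.Properties using (∈-allFin)
open import Relation.Nullary using (¬_; yes; no; ¬?; _×-dec_; _⊎-dec_)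
open import Relation.Nullary.Decidable using (¬¬-excluded-middle; decidable-stable)
open import Relation.Binary using (Rel)
open import Relation.Binary.PropositionalEquality using (_≡_; _≢_; refl; sym; subst)
open import Relation.Binary.Construct.Closure.ReflexiveTransitive as Star
  using (Star; ε; _◅_; _◅◅_)
open import Level using (0ℓ)

three-members⇒3≤∣p∣ : ∀ {n} {p : Subset n} {x y z} → x ∈ p → y ∈ p → z ∈ p →
  y ≢ x → z ≢ x → z ≢ y → 3 ≤ ∣ p ∣
three-members⇒3≤∣p∣ {n} x∈p y∈p z∈p y≢x z≢x z≢y =
  member⇒< x∈p (member⇒< y∈p-x (member⇒< z∈p-x-y z≤n))
  where
  member⇒< : ∀ {m} {q : Subset n} {v} → v ∈ q → m ≤ ∣ q - v ∣ → suc m ≤ ∣ q ∣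
  member⇒< v∈q m≤ = ≤-trans (s≤s m≤) (x∈p⇒∣p-x∣<∣p∣ v∈q)
  y∈p-x = x∈p∧x≢y⇒x∈p-y y∈p y≢x
  z∈p-x-y = x∈p∧x≢y⇒x∈p-y (x∈p∧x≢y⇒x∈p-y z∈p z≢x) z≢y

module _ {n : ℕ} (P : Subset n → Set) where

  Maximal : Subset n → Set
  Maximal S = ∀ S′ → S ⊆ S′ → P S′ → S′ ⊆ S

  module _ (P-⊆ : ∀ {S S′} → S ⊆ S′ → P S′ → P S) where

    private
      Saturated : List (Fin n) → Subset n → Set
      Saturated vs S = ∀ v → v List.∈ vs → v ∉ S → ¬ P (S ∪ ⁅ v ⁆)

      saturate : ∀ vs S → P S → ¬ ¬ (∃ λ S′ → S ⊆ S′ × P S′ × Saturated vs S′)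
      saturate [] S pS k = k (S , (λ v∈S → v∈S) , pS , λ _ ())
      saturate (v ∷ vs) S pS k = ¬¬-excluded-middle λ where
        (yes pS+v) → saturate vs (S ∪ ⁅ v ⁆) pS+v λ (S′ , S+v⊆S′ , pS′ , sat) →
          k (S′ , S+v⊆S′ ∘ p⊆p∪q ⁅ v ⁆ , pS′ , λ where
               u (here refl) u∉S′ _ → u∉S′ (S+v⊆S′ (q⊆p∪q S ⁅ v ⁆ (x∈⁅x⁆ v)))
               u (there u∈vs) → sat u u∈vs)
        (no ¬pS+v) → saturate vs S pS λ (S′ , S⊆S′ , pS′ , sat) →
          k (S′ , S⊆S′ , pS′ , λ where
               u (here refl) _ pS′+v →
                 ¬pS+v (P-⊆ (x∈p∪q⁺ ∘ map₁ S⊆S′ ∘ x∈p∪q⁻ S ⁅ v ⁆) pS′+v)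
               u (there u∈vs) → sat u u∈vs)

    ¬¬-maximal-extension : ∀ {S} → P S → ¬ ¬ (∃ λ S′ → S ⊆ S′ × P S′ × Maximal S′)
    ¬¬-maximal-extension pS k =
      saturate (allFin n) _ pS λ (S′ , S⊆S′ , pS′ , sat) → k (S′ , S⊆S′ , pS′ , maximal sat)
      where
      maximal : ∀ {S′} → Saturated (allFin n) S′ → Maximal S′
      maximal {S′} sat S″ S′⊆S″ pS″ {u} u∈S″ with u ∈? S′
      ... | yes u∈S′ = u∈S′
      ... | no u∉S′ = ⊥-elim (sat u (∈-allFin u) u∉S′ (P-⊆ S′+u⊆S″ pS″))
        where
        S′+u⊆S″ : S′ ∪ ⁅ u ⁆ ⊆ S″
        S′+u⊆S″ = [ S′⊆S″ , (λ v∈u → subst (_∈ S″) (sym (x∈⁅y⁆⇒x≡y u v∈u)) u∈S″) ]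
                  ∘ x∈p∪q⁻ S′ ⁅ u ⁆

module _ {n : ℕ} (G : Graph n) where
  open Graph G renaming (sym to Adj-sym)

  neighbour-other-than : MinDegree≥2 G → ∀ v x → ∃ λ w → w ≢ x × Adj v w
  neighbour-other-than δ v x with δ v
  ... | u₁ , u₂ , u₁≢u₂ , v~u₁ , v~u₂ with u₁ ≟ x
  ...   | yes refl = u₂ , u₁≢u₂ ∘ sym , v~u₂
  ...   | no u₁≢x = u₁ , u₁≢x , v~u₁

  reachIn-reverse : ∀ {S x y} → ReachIn G S x y → ReachIn G S y x
  reachIn-reverse = Star.reverse λ (sx , sy , x~y) → sy , sx , Adj-sym x~y

  reachIn-mono : ∀ {S S′ : Fin n → Set} → (∀ {v} → S v → S′ v) →
    ∀ {x y} → ReachIn G S x y → ReachIn G S′ x y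
  reachIn-mono S⊆S′ = Star.map λ (sx , sy , x~y) → S⊆S′ sx , S⊆S′ sy , x~y

  reachIn-source : ∀ {S x y} → ReachIn G S x y → x ≡ y ⊎ S x
  reachIn-source ε = inj₁ refl
  reachIn-source ((sx , _ , _) ◅ _) = inj₂ sx

  reachIn-target : ∀ {S x y} → ReachIn G S x y → x ≡ y ⊎ S y
  reachIn-target = map₁ sym ∘ reachIn-source ∘ reachIn-reverse

  reachIn-before-first-visit : ∀ {S x y} → ReachIn G S x y → x ≢ y →
    ∃ λ w → ReachIn G (λ v → S v × v ≢ y) x w × S w × Adj w y
  reachIn-before-first-visit ε x≢y = ⊥-elim (x≢y refl)
  reachIn-before-first-visit {y = y} (_◅_ {i = x} {j = u} (sx , su , x~u) p) x≢y
    with u ≟ y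
  ... | yes refl = x , ε , sx , x~u
  ... | no u≢y with reachIn-before-first-visit p u≢y
  ...   | w , u⇝w , sw , w~y = w , ((sx , x≢y) , (su , u≢y) , x~u) ◅ u⇝w , sw , w~y

  notSeparable-refl : ∀ x → NotSeparableBy≤1 G x x
  notSeparable-refl x = ε , λ _ _ _ → ε

  notSeparable-sym : ∀ {x y} → NotSeparableBy≤1 G x y → NotSeparableBy≤1 G y x
  notSeparable-sym (x⇝y , avoiding) =
    Star.reverse Adj-sym x⇝y , λ z z≢y z≢x → reachIn-reverse (avoiding z z≢x z≢y)

  candidate-⊆ : ∀ {S S′} → S ⊆ S′ → BlockCandidate G S′ → BlockCandidate G S
  candidate-⊆ S⊆S′ c x y x∈S y∈S = c x y (S⊆S′ x∈S) (S⊆S′ y∈S)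

  candidate-walk : ∀ {S} → BlockCandidate G S → ∀ {x y} → x ∈ S → y ∈ S → Star Adj x y
  candidate-walk c {x} {y} x∈S y∈S with adj? x y
  ... | yes x~y = x~y ◅ ε
  ... | no ¬x~y = proj₁ (c x y x∈S y∈S ¬x~y)

  candidate-walk-avoiding : ∀ {S} → BlockCandidate G S → ∀ {x y} → x ∈ S → y ∈ S →
    ∀ z → z ≢ x → z ≢ y → ReachIn G (λ v → v ≢ z) x y
  candidate-walk-avoiding c {x} {y} x∈S y∈S z z≢x z≢y with adj? x y
  ... | yes x~y = (z≢x ∘ sym , z≢y ∘ sym , x~y) ◅ ε
  ... | no ¬x~y = proj₂ (c x y x∈S y∈S ¬x~y) z z≢x z≢y

  singleton-candidate : ∀ w → BlockCandidate G ⁅ w ⁆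
  singleton-candidate w x y x∈w y∈w _
    rewrite x∈⁅y⁆⇒x≡y w x∈w | x∈⁅y⁆⇒x≡y w y∈w = notSeparable-refl w

  candidate-∪-singleton : ∀ {S w} → BlockCandidate G S →
    (∀ u → u ∈ S → ¬ Adj w u → NotSeparableBy≤1 G w u) → BlockCandidate G (S ∪ ⁅ w ⁆)
  candidate-∪-singleton {S} {w} c w-joined x y x∈S+w y∈S+w ¬x~y
    with x∈p∪q⁻ S ⁅ w ⁆ x∈S+w | x∈p∪q⁻ S ⁅ w ⁆ y∈S+w
  ... | inj₁ x∈S | inj₁ y∈S = c x y x∈S y∈S ¬x~y
  ... | inj₁ x∈S | inj₂ y∈w rewrite x∈⁅y⁆⇒x≡y w y∈w =
    notSeparable-sym (w-joined x x∈S (¬x~y ∘ Adj-sym))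
  ... | inj₂ x∈w | inj₁ y∈S rewrite x∈⁅y⁆⇒x≡y w x∈w = w-joined y y∈S ¬x~y
  ... | inj₂ x∈w | inj₂ y∈w rewrite x∈⁅y⁆⇒x≡y w x∈w | x∈⁅y⁆⇒x≡y w y∈w =
    notSeparable-refl w

  edge-candidate : ∀ {x u} → Adj x u → BlockCandidate G (⁅ x ⁆ ∪ ⁅ u ⁆)
  edge-candidate {x} x~u = candidate-∪-singleton (singleton-candidate x) u-joined
    where
    u-joined : ∀ v → v ∈ ⁅ x ⁆ → ¬ Adj _ v → NotSeparableBy≤1 G _ v
    u-joined v v∈x ¬u~v rewrite x∈⁅y⁆⇒x≡y x v∈x = ⊥-elim (¬u~v (Adj-sym x~u))

  ¬¬-block-containing : ∀ {S} → BlockCandidate G S → ¬ ¬ (∃ λ C → S ⊆ C × IsBlock G C)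
  ¬¬-block-containing = ¬¬-maximal-extension (BlockCandidate G) candidate-⊆

  block-not-singleton : ∀ {B x u} → IsBlock G B → Adj x u → ¬ (∀ {v} → v ∈ B → v ≡ x)
  block-not-singleton {B} {x} {u} (_ , maximal) x~u only-x =
    irrefl (subst (Adj x) (only-x (maximal _ B⊆x+u (edge-candidate x~u) u∈x+u)) x~u)
    where
    B⊆x+u : B ⊆ ⁅ x ⁆ ∪ ⁅ u ⁆
    B⊆x+u v∈B = p⊆p∪q ⁅ u ⁆ (subst (_∈ ⁅ x ⁆) (sym (only-x v∈B)) (x∈⁅x⁆ x))
    u∈x+u = q⊆p∪q ⁅ x ⁆ ⁅ u ⁆ (x∈⁅x⁆ u)

  module _ {B : Subset n} (blkB : IsBlock G B) where

    -- Otherwise B ∪ {w} is still a candidate: w reaches each u ∈ B through a,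
    -- and avoiding a through b.
    block-exit-separates : ∀ {a w b} → a ∈ B → w ∉ B → Adj a w →
      ReachIn G (λ v → v ≢ a) w b → b ∈ B → ⊥
    block-exit-separates {a} {w} {b} a∈B w∉B a~w w⇝b b∈B =
      w∉B (proj₂ blkB _ (p⊆p∪q ⁅ w ⁆) (candidate-∪-singleton (proj₁ blkB) w-joined)
                 (q⊆p∪q B ⁅ w ⁆ (x∈⁅x⁆ w)))
      where
      b≢a : b ≢ a
      b≢a with reachIn-target w⇝b
      ... | inj₁ refl = λ b≡a → w∉B (subst (_∈ B) (sym b≡a) a∈B)
      ... | inj₂ b≢a = b≢a
      w-joined : ∀ u → u ∈ B → ¬ Adj w u → NotSeparableBy≤1 G w u
      w-joined u u∈B _ = Adj-sym a~w ◅ candidate-walk (proj₁ blkB) a∈B u∈B , avoiding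
        where
        avoiding : ∀ z → z ≢ w → z ≢ u → ReachIn G (λ v → v ≢ z) w u
        avoiding z z≢w z≢u with z ≟ a
        ... | yes refl =
          w⇝b ◅◅ candidate-walk-avoiding (proj₁ blkB) b∈B u∈B z (b≢a ∘ sym) z≢u
        ... | no z≢a = (z≢w ∘ sym , z≢a ∘ sym , Adj-sym a~w)
                       ◅ candidate-walk-avoiding (proj₁ blkB) a∈B u∈B z z≢a z≢u

    Outside : Rel (Fin n) 0ℓ
    Outside u v = u ∉ B × Adj u v

    outside-walk-avoids : ∀ {a u b} → a ∈ B → b ≢ a → Star Outside u b →
      ReachIn G (λ v → v ≢ a) u b
    outside-walk-avoids a∈B b≢a ε = ε
    outside-walk-avoids {a} a∈B b≢a ((u∉B , u~v) ◅ v⇝b) =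
      (∉B⇒≢a u∉B , source≢a v⇝b , u~v) ◅ outside-walk-avoids a∈B b≢a v⇝b
      where
      ∉B⇒≢a : ∀ {v} → v ∉ B → v ≢ a
      ∉B⇒≢a v∉B refl = v∉B a∈B
      source≢a : ∀ {v} → Star Outside v _ → v ≢ a
      source≢a ε = b≢a
      source≢a ((v∉B , _) ◅ _) = ∉B⇒≢a v∉B

    reachIn-entry : ∀ {S v y} → ReachIn G S v y → y ∈ B →
      ∃ λ b → b ∈ B × Star Outside v b × ReachIn G (λ u → u ∈ B × S u) b y
    reachIn-entry ε y∈B = _ , y∈B , ε , ε
    reachIn-entry {v = v} ((sv , su , v~u) ◅ u⇝y) y∈B
      with reachIn-entry u⇝y y∈B | v ∈? B
    ... | b , b∈B , u⇝b , b⇝y | no v∉B = b , b∈B , (v∉B , v~u) ◅ u⇝b , b⇝y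
    ... | b , b∈B , ε , b⇝y | yes v∈B = v , v∈B , ε , ((v∈B , sv) , (b∈B , su) , v~u) ◅ b⇝y
    ... | b , b∈B , u⇝b@((u∉B , _) ◅ _) , b⇝y | yes v∈B with b ≟ v
    ...   | yes refl = b , b∈B , ε , b⇝y
    ...   | no b≢v =
      ⊥-elim (block-exit-separates v∈B u∉B v~u (outside-walk-avoids v∈B b≢v u⇝b) b∈B)

    reachIn-within-block : ∀ {S x y} → x ∈ B → y ∈ B → ReachIn G S x y →
      ReachIn G (λ v → v ∈ B × S v) x y
    reachIn-within-block x∈B y∈B x⇝y with reachIn-entry x⇝y y∈B
    ... | _ , _ , ε , x⇝y′ = x⇝y′
    ... | _ , _ , (x∉B , _) ◅ _ , _ = ⊥-elim (x∉B x∈B)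

    block-connected : Connected G → ∀ {x y} → x ∈ B → y ∈ B → ReachIn G (_∈ B) x y
    block-connected conn {x} {y} x∈B y∈B =
      reachIn-mono proj₁ (reachIn-within-block {S = λ _ → ⊤} x∈B y∈B
                           (Star.map (λ x~y → tt , tt , x~y) (conn x y)))

    block-connected-without : ∀ {x y z} → x ∈ B → y ∈ B → x ≢ z → y ≢ z →
      ReachIn G (λ v → v ∈ B × v ≢ z) x y
    block-connected-without {z = z} x∈B y∈B x≢z y≢z = reachIn-within-block x∈B y∈B
      (candidate-walk-avoiding (proj₁ blkB) x∈B y∈B z (x≢z ∘ sym) (y≢z ∘ sym))

  module _ {T : Rel (Subset n) 0ℓ} (rbt : ReducedBlockTree G T)
           {B B′ : Subset n} (blkB : IsBlock G B) (blkB′ : IsBlock G B′)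
           (B-leaf : ∀ C → T B C → C ≡ B′)
           {x y : Fin n} (x∈B : x ∈ B) (x∈B′ : x ∈ B′) (y∈B : y ∈ B) (x≢y : x ≢ y)
           (B⊆xy : ∀ {v} → v ∈ B → v ≡ x ⊎ v ≡ y) where
    open ReducedBlockTree rbt

    private
      ∉xy⇒∉B : ∀ {w} → w ≢ x → w ≢ y → w ∉ B
      ∉xy⇒∉B w≢x w≢y w∈B = [ w≢x , w≢y ] (B⊆xy w∈B)

      YSide : Fin n → Set
      YSide v = ReachIn G (λ u → u ≢ x) v y

      ySide-≢x : ∀ {v} → YSide v → v ≢ x
      ySide-≢x v⇝y with reachIn-source v⇝y
      ... | inj₁ refl = x≢y ∘ sym
      ... | inj₂ v≢x = v≢x

      not-on-both-sides : ∀ {v} → ReachIn G (λ u → u ≢ y) v x → YSide v → ⊥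
      not-on-both-sides {v} v⇝x v⇝y with v ≟ y
      ... | yes refl = [ x≢y ∘ sym , (λ y≢y → y≢y refl) ] (reachIn-source v⇝x)
      ... | no v≢y with reachIn-before-first-visit v⇝y v≢y
      ...   | w , v⇝w , w≢x , w~y =
        block-exit-separates blkB y∈B (∉xy⇒∉B w≢x w≢y) (Adj-sym w~y)
          (reachIn-mono proj₂ (reachIn-reverse v⇝w) ◅◅ v⇝x) x∈B
        where
        w≢y : w ≢ y
        w≢y = [ (λ { refl → v≢y }) , proj₂ ] (reachIn-target v⇝w)

      YBlock : Subset n → Set
      YBlock C = ∀ {u} → u ∈ C → YSide u

      block-meeting-y-side : ∀ {C v} → IsBlock G C → v ∈ C → YSide v → C ≡ B ⊎ YBlock C
      block-meeting-y-side {C} {v} blkC v∈C v⇝y with x ∈? C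
      ... | no x∉C = inj₂ λ u∈C →
        candidate-walk-avoiding (proj₁ blkC) u∈C v∈C x
          (λ { refl → x∉C u∈C }) (λ { refl → ySide-≢x v⇝y refl }) ◅◅ v⇝y
      ... | yes x∈C with v ≟ y
      ...   | yes refl = inj₁ (⊆-antisym (proj₂ blkB C B⊆C (proj₁ blkC)) B⊆C)
        where
        B⊆C : B ⊆ C
        B⊆C u∈B with B⊆xy u∈B
        ... | inj₁ refl = x∈C
        ... | inj₂ refl = v∈C
      ...   | no v≢y with adj? x v
      ...     | yes x~v =
        ⊥-elim (block-exit-separates blkB x∈B (∉xy⇒∉B (ySide-≢x v⇝y) v≢y) x~v v⇝y y∈B)
      ...     | no ¬x~v = ⊥-elim (not-on-both-sides
        (reachIn-reverse (proj₂ (proj₁ blkC x v x∈C v∈C ¬x~v) y (x≢y ∘ sym) (v≢y ∘ sym)))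
        v⇝y)

      B′-not-y-block : ¬ YBlock B′
      B′-not-y-block yB′ = ySide-≢x (yB′ x∈B′) refl

      -- Entering B from a y-block C would make C the unique tree neighbour B′ of B.
      y-block-not-linked-to-B′ : ∀ {C} → YBlock C → Star T C B′ → ⊥
      y-block-not-linked-to-B′ yC ε = B′-not-y-block yC
      y-block-not-linked-to-B′ {C} yC (_◅_ {j = C₁} C-C₁ C₁⇝B′)
        with edges-in-GB C C₁ C-C₁
      ... | _ , blkC₁ , _ , v , v∈C∩C₁ with x∈p∩q⁻ C C₁ v∈C∩C₁
      ... | v∈C , v∈C₁ with block-meeting-y-side blkC₁ v∈C₁ (yC v∈C)
      ...   | inj₂ yC₁ = y-block-not-linked-to-B′ yC₁ C₁⇝B′
      ...   | inj₁ refl with B-leaf C (T-sym C B C-C₁)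
      ...     | refl = B′-not-y-block yC

    leaf-block-not-bridge : MinDegree≥2 G → ⊥
    leaf-block-not-bridge δ with neighbour-other-than δ y x
    ... | w , w≢x , y~w = ¬¬-block-containing (singleton-candidate w) λ (C , w⊆C , blkC) →
      block-at-w (w⊆C (x∈⁅x⁆ w)) blkC
      where
      block-at-w : ∀ {C} → w ∈ C → IsBlock G C → ⊥
      block-at-w w∈C blkC
        with block-meeting-y-side blkC w∈C ((w≢x , x≢y ∘ sym , Adj-sym y~w) ◅ ε)
      ... | inj₁ refl = ∉xy⇒∉B w≢x (λ { refl → irrefl y~w }) w∈C
      ... | inj₂ yC = y-block-not-linked-to-B′ yC (spanning-connected _ _ blkC blkB′)

  leaf-block-has-three-vertices : ∀ {T B} → MinDegree≥2 G → ReducedBlockTree G T →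
    IsBlock G B → IsLeaf G T B → 3 ≤ ∣ B ∣
  leaf-block-has-three-vertices {B = B} δ rbt blkB (B′ , B-B′ , B-leaf)
    with ReducedBlockTree.edges-in-GB rbt B B′ B-B′
  ... | _ , blkB′ , _ , x , x∈B∩B′ = from-shared-vertex (x∈p∩q⁻ B B′ x∈B∩B′)
    where
    from-shared-vertex : x ∈ B × x ∈ B′ → 3 ≤ ∣ B ∣
    from-shared-vertex (x∈B , x∈B′) with any? (λ y → y ∈? B ×-dec ¬? (y ≟ x))
    ... | no ∄y = ⊥-elim (block-not-singleton blkB x~u
      λ {v} v∈B → decidable-stable (v ≟ x) λ v≢x → ∄y (v , v∈B , v≢x))
      where
      x~u = proj₂ (proj₂ (neighbour-other-than δ x x))
    ... | yes (y , y∈B , y≢x) with any? (λ z → z ∈? B ×-dec ¬? (z ≟ x) ×-dec ¬? (z ≟ y))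
    ...   | yes (z , z∈B , z≢x , z≢y) = three-members⇒3≤∣p∣ x∈B y∈B z∈B y≢x z≢x z≢y
    ...   | no ∄z = ⊥-elim (leaf-block-not-bridge rbt blkB blkB′ B-leaf x∈B x∈B′ y∈B
      (y≢x ∘ sym)
      (λ {v} v∈B → decidable-stable (v ≟ x ⊎-dec v ≟ y) λ v∉xy →
         ∄z (v , v∈B , v∉xy ∘ inj₁ , v∉xy ∘ inj₂))
      δ)

corollary4p12 : ∀ {n} (G : Graph n) → Connected G → MinDegree≥2 G →
    (T : Rel (Subset n) 0ℓ) → ReducedBlockTree G T →
    ∀ B → IsBlock G B → IsLeaf G T B →
    3 ≤ ∣ B ∣ × InducesTwoConnected G B
corollary4p12 G conn δ T rbt B blkB leaf =
  three , three ,
  (λ _ _ → block-connected G blkB conn) ,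
  (λ _ _ _ _ x∈B y∈B → block-connected-without G blkB x∈B y∈B)
  where
  three = leaf-block-has-three-vertices G δ rbt blkB leaf
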